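{- Let $\Gamma_1,\Delta_1,\ldots,\Gamma_n,\Delta_n$ be finite multisets of propositional variables. Then $\models_{\mathbf{A}} \Gamma_1 \vdash \Delta_1 \mid \ldots \mid \Gamma_n \vdash \Delta_n$ if and only if there exist non-negative integers $\lambda_1,\ldots,\lambda_n$, with $\lambda_i>0$ for some $i$, such that the multiset unions satisfy $\biguplus_{i=1}^n \lambda_i\Gamma_i = \biguplus_{i=1}^n \lambda_i\Delta_i$, where $\lambda\Gamma$ denotes the union of $\lambda$ copies of $\Gamma$.
   Context: A hypersequent $\Gamma_1\vdash\Delta_1\mid\ldots\mid\Gamma_n\vdash\Delta_n$ (a finite multiset of sequents, each a pair of finite multisets of formulas) is valid in abelian logic, written $\models_{\mathbf{A}}$, iff for every valuation $v$ of propositional variables into $\mathbb{Q}$ there is $i$ with $\sum_{A\in\Gamma_i}v(A)\le\sum_{B\in\Delta_i}v(B)$ (empty sums are $0$). (This is equivalent to validity in all lattice-ordered abelian groups of the formula $\bigvee_i\big((\sum\Gamma_i)\to(\sum\Delta_i)\big)$.) -}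

module Defs where

open import Data.Nat using (ℕ; zero; suc)
open import Data.Fin using (Fin)
open import Data.List using (List; []; _++_; map; foldr; concat; replicate; allFin)
open import Data.Product using (_×_; proj₁; proj₂; ∃)
open import Data.Rational using (ℚ; _≤_; _+_; 0ℚ)

Var : Set
Var = ℕ

-- A finite multiset of propositional variables, represented as a list
-- (multiset equality = permutation, Data.List.Relation.Binary.Permutation).
Multiset : Set
Multiset = List Var

Sequent : Set
Sequent = Multiset × Multiset

Hypersequent : ℕ → Set
Hypersequent n = Fin n → Sequent

Valuation : Set
Valuation = Var → ℚ

sumV : Valuation → Multiset → ℚ
sumV v Γ = foldr (λ a s → v a + s) 0ℚ Γ

ValidA : ∀ {n} → Hypersequent n → Set
ValidA {n} H = ∀ (v : Valuation) → ∃ λ (i : Fin n) →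
  sumV v (proj₁ (H i)) ≤ sumV v (proj₂ (H i))

copies : ℕ → Multiset → Multiset
copies k Γ = concat (replicate k Γ)

bigUnion : ∀ {n} → (Fin n → ℕ) → (Fin n → Multiset) → Multiset
bigUnion {n} lam G = concat (map (λ i → copies (lam i) (G i)) (allFin n))

{-# OPTIONS --safe #-}
module Submission where

-- Soundness: if ⨄ λᵢΓᵢ and ⨄ λᵢΔᵢ are the same multiset, they have the same sum under every
-- valuation, which is impossible if every component fails and some λᵢ > 0.
--
-- Completeness is Fourier–Motzkin elimination. A coefficient vector ν stands for the sequent
-- ⨄ νᵢΓᵢ ⊢ ⨄ νᵢΔᵢ, whose slack ΣΔ − ΣΓ is linear in ν and in the valuation. The unit vectors
-- cover every valuation, in the sense that some slack is ≥ 0 there. A variable m is eliminated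
-- by keeping the vectors balanced in m and adding, for each p with more m on the right and each
-- q with more m on the left, the positive combination of p and q in which m cancels. The new
-- list still covers every valuation: where all new slacks are negative, the old slacks are
-- affine in the value y of m, the combinations put every lower bound on y below every upper
-- bound, and a y in between makes every old slack negative. When no variable is left, the
-- surviving vectors are balanced in every variable, i.e. they give equal multisets.

open import Defs
open import Algebra.Bundles using (Ring)
open import Data.Fin using (Fin; zero; suc)
open import Data.Fin.Properties using (any?)
open import Data.List using (List; []; _∷_; _++_; [_]; length; filter; foldr; concat; map; allFin; cartesianProductWith)
import Data.List.Properties as List
open import Data.List.Membership.Propositional using (_∈_; _∉_; find; lose)
open import Data.List.Membership.Propositional.Properties
  using (∈-∃++; ∈-map⁺; ∈-map⁻; ∈-++⁺ˡ; ∈-++⁺ʳ; ∈-++⁻; ∈-concat⁺′; ∈-allFin; ∈-filter⁺; ∈-filter⁻;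
         ∈-cartesianProductWith⁺; ∈-cartesianProductWith⁻)
open import Data.List.Relation.Binary.Permutation.Propositional using (_↭_; ↭-refl; ↭-sym; ↭-trans; prep; ↭⇒↭ₛ)
import Data.List.Relation.Binary.Permutation.Propositional.Properties as ↭
open import Data.List.Relation.Unary.All as All using (All)
import Data.List.Relation.Unary.All.Properties as All
open import Data.List.Relation.Unary.Any as Any using (Any; here; there)
open import Data.Nat as ℕ using (ℕ; zero; suc; _>_; _∸_)
import Data.Nat.Properties as ℕ
open import Data.Nat.Tactic.RingSolver using (solve-∀)
open import Data.Product using (_×_; ∃; _,_; proj₁; proj₂)
open import Data.Rational as ℚ
  using (ℚ; 0ℚ; 1ℚ; _+_; _*_; -_; _-_; _≤_; _<_; 1/_; ≢-nonZero; positive; negative; nonNegative)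
import Data.Rational.Properties as ℚ
open import Data.Rational.Solver using (module +-*-Solver)
open import Data.Sum using (_⊎_; inj₁; inj₂)
open import Function using (_∘_; id)
open import Function.Bundles using (_⇔_; mk⇔)
open import Relation.Binary.Bundles using (DecTotalOrder)
open import Relation.Binary.Definitions using (Tri; tri<; tri≈; tri>)
open import Relation.Binary.PropositionalEquality
  using (setoid; _≡_; _≢_; ≢-sym; refl; sym; trans; cong; cong₂; subst; subst₂; module ≡-Reasoning)
open import Relation.Nullary using (¬_; Dec; yes; no; contradiction)
import Algebra.Properties.Semiring.Mult (Ring.semiring ℚ.+-*-ring) as Mult
open import Data.List.Extrema (DecTotalOrder.totalOrder ℚ.≤-decTotalOrder)
  using (min; max; argmin-sel; argmax-sel; min≤xs; xs≤max)
open import Data.List.Membership.DecPropositional ℕ._≟_ using (_∈?_)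
import Data.List.Relation.Binary.Permutation.Setoid.Properties (setoid ℚ) as ↭ₛ

ι : ℕ → ℚ
ι n = n Mult.× 1ℚ

ι-+ : ∀ m n → ι (m ℕ.+ n) ≡ ι m + ι n
ι-+ = Mult.×-homo-+ 1ℚ

ι-* : ∀ m n → ι (m ℕ.* n) ≡ ι m * ι n
ι-* = Mult.×1-homo-*

ι-∸ : ∀ {m n} → n ℕ.≤ m → ι (m ∸ n) ≡ ι m - ι n
ι-∸ {m} {n} n≤m = begin
  ι (m ∸ n)                 ≡⟨ solve 2 (λ x y → x := (x :+ y) :- y) refl (ι (m ∸ n)) (ι n) ⟩
  (ι (m ∸ n) + ι n) - ι n   ≡⟨ cong (_- ι n) (ι-+ (m ∸ n) n) ⟨
  ι (m ∸ n ℕ.+ n) - ι n     ≡⟨ cong (λ k → ι k - ι n) (ℕ.m∸n+n≡m n≤m) ⟩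
  ι m - ι n                 ∎
  where
  open ≡-Reasoning
  open +-*-Solver

ι-nonneg : ∀ k → 0ℚ ≤ ι k
ι-nonneg zero    = ℚ.≤-refl
ι-nonneg (suc k) = ℚ.+-mono-≤ (ℚ.<⇒≤ (ℚ.positive⁻¹ 1ℚ)) (ι-nonneg k)

ι-pos : ∀ {k} → k > 0 → 0ℚ < ι k
ι-pos {suc k} _ = ℚ.+-mono-<-≤ (ℚ.positive⁻¹ 1ℚ) (ι-nonneg k)

-- Linear constraints in one rational unknown

p<p+1 : ∀ p → p < p + 1ℚ
p<p+1 p = subst (_< p + 1ℚ) (ℚ.+-identityʳ p) (ℚ.+-monoʳ-< p (ℚ.positive⁻¹ 1ℚ))

p-1<p : ∀ p → p - 1ℚ < p
p-1<p p = subst (p - 1ℚ <_) (ℚ.+-identityʳ p) (ℚ.+-monoʳ-< p (ℚ.negative⁻¹ (- 1ℚ)))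

p≤q⇒0≤q-p : ∀ {p q} → p ≤ q → 0ℚ ≤ q - p
p≤q⇒0≤q-p {p} {q} p≤q = subst (_≤ q - p) (ℚ.+-inverseʳ p) (ℚ.+-monoˡ-≤ (- p) p≤q)

p<-q⇒p+q<0 : ∀ {p q} → p < - q → p + q < 0ℚ
p<-q⇒p+q<0 {p} {q} p<-q = subst (p + q <_) (ℚ.+-inverseˡ q) (ℚ.+-monoˡ-< q p<-q)

p+q<0⇒p<-q : ∀ {p q} → p + q < 0ℚ → p < - q
p+q<0⇒p<-q {p} {q} p+q<0 =
  subst₂ _<_ (solve 2 (λ p q → (p :+ q) :- q := p) refl p q) (ℚ.+-identityˡ (- q)) (ℚ.+-monoˡ-< (- q) p+q<0)
  where open +-*-Solver

∃-between : ∀ ls us → (∀ {l u} → l ∈ ls → u ∈ us → l < u) → ∃ λ y → All (_< y) ls × All (y <_) us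
∃-between ls us ls<us =
  let y , L<y , y<U = ℚ.<-dense L<U
  in y , All.tabulate (λ l∈ls → ℚ.≤-<-trans (All.lookup (xs≤max z ls) l∈ls) L<y)
       , All.tabulate (λ u∈us → ℚ.<-≤-trans y<U (All.lookup (min≤xs (L + 1ℚ) us) u∈us))
  where
  z L U : ℚ
  z = min 0ℚ us - 1ℚ
  L = max z ls
  U = min (L + 1ℚ) us
  L<us : ∀ {u} → u ∈ us → L < u
  L<us u∈us with argmax-sel id z ls
  ... | inj₁ L≡z  = subst (_< _) (sym L≡z) (ℚ.<-≤-trans (p-1<p (min 0ℚ us)) (All.lookup (min≤xs 0ℚ us) u∈us))
  ... | inj₂ L∈ls = ls<us L∈ls u∈us
  L<U : L < U
  L<U with argmin-sel id (L + 1ℚ) us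
  ... | inj₁ U≡L+1 = subst (L <_) (sym U≡L+1) (p<p+1 L)
  ... | inj₂ U∈us  = L<us U∈us

-- Junk value 0 when α = 0.
root : ℚ → ℚ → ℚ
root α β with α ℚ.≟ 0ℚ
... | yes _   = 0ℚ
... | no α≢0 = - β * 1/_ α {{≢-nonZero α≢0}}

*-root : ∀ {α} β → α ≢ 0ℚ → α * root α β ≡ - β
*-root {α} β α≢0 with α ℚ.≟ 0ℚ
... | yes α≡0 = contradiction α≡0 α≢0
... | no α≢0 = trans (solve 3 (λ a b i → a :* (b :* i) := b :* (a :* i)) refl α (- β) _)
  (trans (cong (- β *_) (ℚ.*-inverseʳ α {{≢-nonZero α≢0}})) (ℚ.*-identityʳ (- β)))
  where open +-*-Solver

below-root : ∀ {α β y} → 0ℚ < α → y < root α β → α * y + β < 0ℚ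
below-root {α} {β} {y} α>0 y<r =
  p<-q⇒p+q<0 (subst (α * y <_) (*-root β (≢-sym (ℚ.<⇒≢ α>0))) (ℚ.*-monoʳ-<-pos α {{positive α>0}} y<r))

above-root : ∀ {α β y} → α < 0ℚ → root α β < y → α * y + β < 0ℚ
above-root {α} {β} {y} α<0 r<y =
  p<-q⇒p+q<0 (subst (α * y <_) (*-root β (ℚ.<⇒≢ α<0)) (ℚ.*-monoʳ-<-neg α {{negative α<0}} r<y))

-- Multiplying by -α′ > 0 shows that root α′ β′ satisfies α * y + β < 0.
root<root : ∀ {α β α′ β′} → 0ℚ < α → α′ < 0ℚ → (- α′) * β + α * β′ < 0ℚ → root α′ β′ < root α β
root<root {α} {β} {α′} {β′} α>0 α′<0 eliminated = ℚ.*-cancelˡ-<-nonNeg α {{nonNegative (ℚ.<⇒≤ α>0)}}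
  (subst (α * r′ <_) (sym (*-root β (≢-sym (ℚ.<⇒≢ α>0)))) (p+q<0⇒p<-q r′-below))
  where
  open ≡-Reasoning
  open +-*-Solver
  r′ : ℚ
  r′ = root α′ β′
  scaled : (- α′) * (α * r′ + β) ≡ (- α′) * β + α * β′
  scaled = begin
    (- α′) * (α * r′ + β)           ≡⟨ solve 4 (λ c a z b → (:- c) :* (a :* z :+ b) := (:- c) :* b :+ a :* (:- (c :* z)))
                                               refl α′ α r′ β ⟩
    (- α′) * β + α * (- (α′ * r′))  ≡⟨ cong (λ t → (- α′) * β + α * (- t)) (*-root β′ (ℚ.<⇒≢ α′<0)) ⟩
    (- α′) * β + α * (- - β′)       ≡⟨ cong (λ t → (- α′) * β + α * t) (solve 1 (λ b → :- (:- b) := b) refl β′) ⟩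
    (- α′) * β + α * β′             ∎
  r′-below : α * r′ + β < 0ℚ
  r′-below = ℚ.*-cancelˡ-<-nonNeg (- α′) {{nonNegative (ℚ.<⇒≤ (ℚ.neg-antimono-< α′<0))}}
    (subst₂ _<_ (sym scaled) (sym (ℚ.*-zeroʳ (- α′))) eliminated)

affine-feasible : ∀ {A : Set} (α β : A → ℚ) ps ns → All (λ p → 0ℚ < α p) ps → All (λ q → α q < 0ℚ) ns →
  (∀ {p q} → p ∈ ps → q ∈ ns → (- α q) * β p + α p * β q < 0ℚ) →
  ∃ λ y → All (λ x → α x * y + β x < 0ℚ) ps × All (λ x → α x * y + β x < 0ℚ) ns
affine-feasible {A} α β ps ns ps>0 ns<0 eliminated =
  let y , ns<y , y<ps = ∃-between (map root′ ns) (map root′ ps) roots-ordered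
  in y , All.zipWith (λ (α>0 , y<r) → below-root α>0 y<r) (ps>0 , All.map⁻ y<ps)
       , All.zipWith (λ (α<0 , r<y) → above-root α<0 r<y) (ns<0 , All.map⁻ ns<y)
  where
  root′ : A → ℚ
  root′ x = root (α x) (β x)
  roots-ordered : ∀ {l u} → l ∈ map root′ ns → u ∈ map root′ ps → l < u
  roots-ordered l∈ u∈ with ∈-map⁻ root′ l∈ | ∈-map⁻ root′ u∈
  ... | q , q∈ns , refl | p , p∈ps , refl =
    root<root (All.lookup ps>0 p∈ps) (All.lookup ns<0 q∈ns) (eliminated p∈ps q∈ns)

-- Multiplicities and sums

count : Var → Multiset → ℕ
count j = length ∘ filter (j ℕ.≟_)

count-++ : ∀ j xs ys → count j (xs ++ ys) ≡ count j xs ℕ.+ count j ys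
count-++ j xs ys = trans (cong length (List.filter-++ (j ℕ.≟_) xs ys)) (List.length-++ (filter (j ℕ.≟_) xs))

count-copies : ∀ j k Γ → count j (copies k Γ) ≡ k ℕ.* count j Γ
count-copies j zero    Γ = refl
count-copies j (suc k) Γ = trans (count-++ j Γ (copies k Γ)) (cong (count j Γ ℕ.+_) (count-copies j k Γ))

count-∉ : ∀ {j} xs → j ∉ xs → count j xs ≡ 0
count-∉ {j} xs j∉xs = cong length (List.filter-none (j ℕ.≟_) (All.¬Any⇒All¬ xs j∉xs))

count-↭ : ∀ j {xs ys} → xs ↭ ys → count j xs ≡ count j ys
count-↭ j = ↭.↭-length ∘ ↭.filter-↭ (j ℕ.≟_)

count-self : ∀ x xs → count x (x ∷ xs) ≡ suc (count x xs)
count-self x xs = cong length (List.filter-accept (x ℕ.≟_) refl)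

count-∷-cancel : ∀ j x xs ys → count j (x ∷ xs) ≡ count j (x ∷ ys) → count j xs ≡ count j ys
count-∷-cancel j x xs ys eq = ℕ.+-cancelˡ-≡ (count j [ x ]) _ _
  (trans (sym (count-++ j [ x ] xs)) (trans eq (count-++ j [ x ] ys)))

count⇒↭ : ∀ xs ys → (∀ j → count j xs ≡ count j ys) → xs ↭ ys
count⇒↭ [] []       _  = ↭-refl
count⇒↭ [] (y ∷ ys) eq with () ← trans (eq y) (count-self y ys)
count⇒↭ (x ∷ xs) ys eq with ∈-∃++ x∈ys
  where
  x∈ys : x ∈ ys
  x∈ys with x ∈? ys
  ... | yes x∈ys = x∈ys
  ... | no x∉ys with () ← trans (sym (count-self x xs)) (trans (eq x) (count-∉ ys x∉ys))
... | as , bs , refl = ↭-trans (prep x (count⇒↭ xs (as ++ bs) eq′)) (↭-sym (↭.shift x as bs))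
  where
  eq′ : ∀ j → count j xs ≡ count j (as ++ bs)
  eq′ j = count-∷-cancel j x xs (as ++ bs) (trans (eq j) (count-↭ j (↭.shift x as bs)))

sumV-++ : ∀ v xs ys → sumV v (xs ++ ys) ≡ sumV v xs + sumV v ys
sumV-++ v []       ys = sym (ℚ.+-identityˡ _)
sumV-++ v (x ∷ xs) ys = trans (cong (v x +_) (sumV-++ v xs ys)) (sym (ℚ.+-assoc (v x) _ _))

sumV-copies : ∀ v k Γ → sumV v (copies k Γ) ≡ ι k * sumV v Γ
sumV-copies v zero    Γ = sym (ℚ.*-zeroˡ (sumV v Γ))
sumV-copies v (suc k) Γ = begin
  sumV v (Γ ++ copies k Γ)         ≡⟨ sumV-++ v Γ (copies k Γ) ⟩
  sumV v Γ + sumV v (copies k Γ)   ≡⟨ cong (sumV v Γ +_) (sumV-copies v k Γ) ⟩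
  sumV v Γ + ι k * sumV v Γ        ≡⟨ cong (_+ ι k * sumV v Γ) (ℚ.*-identityˡ (sumV v Γ)) ⟨
  1ℚ * sumV v Γ + ι k * sumV v Γ   ≡⟨ ℚ.*-distribʳ-+ (sumV v Γ) 1ℚ (ι k) ⟨
  ι (suc k) * sumV v Γ             ∎
  where open ≡-Reasoning

sumV-↭ : ∀ v {xs ys} → xs ↭ ys → sumV v xs ≡ sumV v ys
sumV-↭ v {xs} {ys} xs↭ys = begin
  sumV v xs                ≡⟨ List.foldr-map _+_ v 0ℚ xs ⟨
  foldr _+_ 0ℚ (map v xs)  ≡⟨ ↭ₛ.foldr-commMonoid ℚ.+-0-isCommutativeMonoid (↭⇒↭ₛ (↭.map⁺ v xs↭ys)) ⟩
  foldr _+_ 0ℚ (map v ys)  ≡⟨ List.foldr-map _+_ v 0ℚ ys ⟩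
  sumV v ys                ∎
  where open ≡-Reasoning

-- count m [ x ] is 1 if x ≡ m and 0 otherwise.
shift : Var → ℚ → Valuation → Valuation
shift m y v x = v x + ι (count m [ x ]) * y

sumV-shift : ∀ m y v Γ → sumV (shift m y v) Γ ≡ ι (count m Γ) * y + sumV v Γ
sumV-shift m y v []      = sym (trans (ℚ.+-identityʳ _) (ℚ.*-zeroˡ y))
sumV-shift m y v (x ∷ Γ) = begin
  (v x + ι c * y) + sumV (shift m y v) Γ      ≡⟨ cong ((v x + ι c * y) +_) (sumV-shift m y v Γ) ⟩
  (v x + ι c * y) + (ι c′ * y + sumV v Γ)     ≡⟨ regroup (v x) (ι c) (ι c′) y (sumV v Γ) ⟩
  (ι c + ι c′) * y + (v x + sumV v Γ)         ≡⟨ cong (λ z → z * y + _) (trans (cong ι (count-++ m [ x ] Γ)) (ι-+ c c′)) ⟨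
  ι (count m (x ∷ Γ)) * y + (v x + sumV v Γ)  ∎
  where
  open ≡-Reasoning
  c c′ : ℕ
  c  = count m [ x ]
  c′ = count m Γ
  regroup : ∀ a c c′ y s → (a + c * y) + (c′ * y + s) ≡ (c + c′) * y + (a + s)
  regroup = solve 5 (λ a c c′ y s → (a :+ c :* y) :+ (c′ :* y :+ s) := (c :+ c′) :* y :+ (a :+ s)) refl
    where open +-*-Solver

⨄ : {I : Set} → List I → (I → ℕ) → (I → Multiset) → Multiset
⨄ is ν G = concat (map (λ i → copies (ν i) (G i)) is)

module _ {I : Set} where

  lincomb : ℕ → (I → ℕ) → ℕ → (I → ℕ) → I → ℕ
  lincomb a ν b μ i = a ℕ.* ν i ℕ.+ b ℕ.* μ i

  sumV-⨄-∷ : ∀ v i is (ν : I → ℕ) G → sumV v (⨄ (i ∷ is) ν G) ≡ ι (ν i) * sumV v (G i) + sumV v (⨄ is ν G)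
  sumV-⨄-∷ v i is ν G =
    trans (sumV-++ v (copies (ν i) (G i)) (⨄ is ν G)) (cong (_+ sumV v (⨄ is ν G)) (sumV-copies v (ν i) (G i)))

  count-⨄-∷ : ∀ j i is (ν : I → ℕ) G → count j (⨄ (i ∷ is) ν G) ≡ ν i ℕ.* count j (G i) ℕ.+ count j (⨄ is ν G)
  count-⨄-∷ j i is ν G =
    trans (count-++ j (copies (ν i) (G i)) (⨄ is ν G)) (cong (ℕ._+ count j (⨄ is ν G)) (count-copies j (ν i) (G i)))

  sumV-⨄-lincomb : ∀ v a ν b μ G (is : List I) →
    sumV v (⨄ is (lincomb a ν b μ) G) ≡ ι a * sumV v (⨄ is ν G) + ι b * sumV v (⨄ is μ G)
  sumV-⨄-lincomb v a ν b μ G []       = sym (cong₂ _+_ (ℚ.*-zeroʳ (ι a)) (ℚ.*-zeroʳ (ι b)))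
  sumV-⨄-lincomb v a ν b μ G (i ∷ is) = begin
    sumV v (⨄ (i ∷ is) (lincomb a ν b μ) G)
      ≡⟨ sumV-⨄-∷ v i is (lincomb a ν b μ) G ⟩
    ι (lincomb a ν b μ i) * s + sumV v (⨄ is (lincomb a ν b μ) G)
      ≡⟨ cong₂ (λ c r → c * s + r) ι-lincomb (sumV-⨄-lincomb v a ν b μ G is) ⟩
    (ι a * ι (ν i) + ι b * ι (μ i)) * s + (ι a * sumV v (⨄ is ν G) + ι b * sumV v (⨄ is μ G))
      ≡⟨ regroup (ι a) (ι b) (ι (ν i)) (ι (μ i)) s _ _ ⟩
    ι a * (ι (ν i) * s + sumV v (⨄ is ν G)) + ι b * (ι (μ i) * s + sumV v (⨄ is μ G))
      ≡⟨ cong₂ (λ x y → ι a * x + ι b * y) (sumV-⨄-∷ v i is ν G) (sumV-⨄-∷ v i is μ G) ⟨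
    ι a * sumV v (⨄ (i ∷ is) ν G) + ι b * sumV v (⨄ (i ∷ is) μ G)
      ∎
    where
    open ≡-Reasoning
    s = sumV v (G i)
    ι-lincomb : ι (lincomb a ν b μ i) ≡ ι a * ι (ν i) + ι b * ι (μ i)
    ι-lincomb = trans (ι-+ (a ℕ.* ν i) (b ℕ.* μ i)) (cong₂ _+_ (ι-* a (ν i)) (ι-* b (μ i)))
    regroup : ∀ a b x y s r r′ → (a * x + b * y) * s + (a * r + b * r′) ≡ a * (x * s + r) + b * (y * s + r′)
    regroup = solve 7 (λ a b x y s r r′ →
      (a :* x :+ b :* y) :* s :+ (a :* r :+ b :* r′) := a :* (x :* s :+ r) :+ b :* (y :* s :+ r′)) refl
      where open +-*-Solver

  count-⨄-lincomb : ∀ j a ν b μ G (is : List I) →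
    count j (⨄ is (lincomb a ν b μ) G) ≡ a ℕ.* count j (⨄ is ν G) ℕ.+ b ℕ.* count j (⨄ is μ G)
  count-⨄-lincomb j a ν b μ G []       = sym (cong₂ ℕ._+_ (ℕ.*-zeroʳ a) (ℕ.*-zeroʳ b))
  count-⨄-lincomb j a ν b μ G (i ∷ is) = begin
    count j (⨄ (i ∷ is) (lincomb a ν b μ) G)
      ≡⟨ count-⨄-∷ j i is (lincomb a ν b μ) G ⟩
    lincomb a ν b μ i ℕ.* c ℕ.+ count j (⨄ is (lincomb a ν b μ) G)
      ≡⟨ cong (lincomb a ν b μ i ℕ.* c ℕ.+_) (count-⨄-lincomb j a ν b μ G is) ⟩
    (a ℕ.* ν i ℕ.+ b ℕ.* μ i) ℕ.* c ℕ.+ (a ℕ.* count j (⨄ is ν G) ℕ.+ b ℕ.* count j (⨄ is μ G))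
      ≡⟨ regroup a b (ν i) (μ i) c _ _ ⟩
    a ℕ.* (ν i ℕ.* c ℕ.+ count j (⨄ is ν G)) ℕ.+ b ℕ.* (μ i ℕ.* c ℕ.+ count j (⨄ is μ G))
      ≡⟨ cong₂ (λ x y → a ℕ.* x ℕ.+ b ℕ.* y) (count-⨄-∷ j i is ν G) (count-⨄-∷ j i is μ G) ⟨
    a ℕ.* count j (⨄ (i ∷ is) ν G) ℕ.+ b ℕ.* count j (⨄ (i ∷ is) μ G)
      ∎
    where
    open ≡-Reasoning
    c = count j (G i)
    regroup : ∀ a b x y c r r′ →
      (a ℕ.* x ℕ.+ b ℕ.* y) ℕ.* c ℕ.+ (a ℕ.* r ℕ.+ b ℕ.* r′) ≡ a ℕ.* (x ℕ.* c ℕ.+ r) ℕ.+ b ℕ.* (y ℕ.* c ℕ.+ r′)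
    regroup = solve-∀

  sumV-⨄-≤ : ∀ v (ν : I → ℕ) {F G} → (∀ i → sumV v (F i) ≤ sumV v (G i)) →
    ∀ is → sumV v (⨄ is ν F) ≤ sumV v (⨄ is ν G)
  sumV-⨄-≤ v ν F≤G []               = ℚ.≤-refl
  sumV-⨄-≤ v ν {F} {G} F≤G (i ∷ is) = subst₂ _≤_ (sym (sumV-⨄-∷ v i is ν F)) (sym (sumV-⨄-∷ v i is ν G))
    (ℚ.+-mono-≤ (ℚ.*-monoˡ-≤-nonNeg (ι (ν i)) {{nonNegative (ι-nonneg (ν i))}} (F≤G i)) (sumV-⨄-≤ v ν F≤G is))

  sumV-⨄-< : ∀ v (ν : I → ℕ) {F G} → (∀ i → sumV v (F i) < sumV v (G i)) →
    ∀ {i is} → i ∈ is → ν i > 0 → sumV v (⨄ is ν F) < sumV v (⨄ is ν G)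
  sumV-⨄-< v ν {F} {G} F<G {is = i ∷ is} (here refl) νi>0 =
    subst₂ _<_ (sym (sumV-⨄-∷ v i is ν F)) (sym (sumV-⨄-∷ v i is ν G))
      (ℚ.+-mono-<-≤ (ℚ.*-monoʳ-<-pos (ι (ν i)) {{positive (ι-pos νi>0)}} (F<G i)) (sumV-⨄-≤ v ν (ℚ.<⇒≤ ∘ F<G) is))
  sumV-⨄-< v ν {F} {G} F<G {is = k ∷ is} (there i∈is) νi>0 =
    subst₂ _<_ (sym (sumV-⨄-∷ v k is ν F)) (sym (sumV-⨄-∷ v k is ν G))
      (ℚ.+-mono-≤-< (ℚ.*-monoˡ-≤-nonNeg (ι (ν k)) {{nonNegative (ι-nonneg (ν k))}} (ℚ.<⇒≤ (F<G k)))
                    (sumV-⨄-< v ν F<G i∈is νi>0))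

⨄-zero : ∀ {I : Set} (is : List I) G → ⨄ is (λ _ → 0) G ≡ []
⨄-zero []       G = refl
⨄-zero (i ∷ is) G = ⨄-zero is G

unit : ∀ {n} → Fin n → Fin n → ℕ
unit zero    zero    = 1
unit zero    (suc _) = 0
unit (suc _) zero    = 0
unit (suc i) (suc k) = unit i k

unit-self : ∀ {n} (i : Fin n) → unit i i ≡ 1
unit-self zero    = refl
unit-self (suc i) = unit-self i

bigUnion-suc : ∀ {n} ν (G : Fin (suc n) → Multiset) →
  bigUnion ν G ≡ copies (ν zero) (G zero) ++ bigUnion (ν ∘ suc) (G ∘ suc)
bigUnion-suc {n} ν G = cong (copies (ν zero) (G zero) ++_)
  (cong concat (trans (List.map-tabulate suc f) (sym (List.map-tabulate id (f ∘ suc)))))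
  where
  f : Fin (suc n) → Multiset
  f i = copies (ν i) (G i)

bigUnion-unit : ∀ {n} (i : Fin n) G → bigUnion (unit i) G ≡ G i
bigUnion-unit {suc n} zero G = begin
  bigUnion (unit zero) G                              ≡⟨ bigUnion-suc (unit zero) G ⟩
  (G zero ++ []) ++ ⨄ (allFin n) (λ _ → 0) (G ∘ suc)  ≡⟨ cong₂ _++_ (List.++-identityʳ (G zero)) (⨄-zero (allFin n) (G ∘ suc)) ⟩
  G zero ++ []                                        ≡⟨ List.++-identityʳ (G zero) ⟩
  G zero                                              ∎
  where open ≡-Reasoning
bigUnion-unit {suc n} (suc i) G = trans (bigUnion-suc (unit (suc i)) G) (bigUnion-unit i (G ∘ suc))

-- Fourier–Motzkin elimination

-- Both sides equal a * g + b * d′ + a * b, where g′ = d′ + a and d = g + b.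
cross-balance : ∀ {g d g′ d′} → g ℕ.≤ d → d′ ℕ.≤ g′ →
  (g′ ∸ d′) ℕ.* g ℕ.+ (d ∸ g) ℕ.* g′ ≡ (g′ ∸ d′) ℕ.* d ℕ.+ (d ∸ g) ℕ.* d′
cross-balance {g} {d} {g′} {d′} g≤d d′≤g′ = begin
  a ℕ.* g ℕ.+ b ℕ.* g′          ≡⟨ cong (λ t → a ℕ.* g ℕ.+ b ℕ.* t) (ℕ.m+[n∸m]≡n d′≤g′) ⟨
  a ℕ.* g ℕ.+ b ℕ.* (d′ ℕ.+ a)  ≡⟨ regroup a b g d′ ⟩
  a ℕ.* (g ℕ.+ b) ℕ.+ b ℕ.* d′  ≡⟨ cong (λ t → a ℕ.* t ℕ.+ b ℕ.* d′) (ℕ.m+[n∸m]≡n g≤d) ⟩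
  a ℕ.* d ℕ.+ b ℕ.* d′          ∎
  where
  open ≡-Reasoning
  a = g′ ∸ d′
  b = d ∸ g
  regroup : ∀ a b g d′ → a ℕ.* g ℕ.+ b ℕ.* (d′ ℕ.+ a) ≡ a ℕ.* (g ℕ.+ b) ℕ.+ b ℕ.* d′
  regroup = solve-∀

module Elimination {n} (H : Hypersequent n) where

  Γ⟨_⟩ Δ⟨_⟩ : (Fin n → ℕ) → Multiset
  Γ⟨ ν ⟩ = bigUnion ν (proj₁ ∘ H)
  Δ⟨ ν ⟩ = bigUnion ν (proj₂ ∘ H)

  slack : Valuation → (Fin n → ℕ) → ℚ
  slack v ν = sumV v Δ⟨ ν ⟩ - sumV v Γ⟨ ν ⟩

  Holds : Valuation → (Fin n → ℕ) → Set
  Holds v ν = 0ℚ ≤ slack v ν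

  Covers : List (Fin n → ℕ) → Set
  Covers S = ∀ v → Any (Holds v) S

  BalancedAt : Var → (Fin n → ℕ) → Set
  BalancedAt j ν = count j Γ⟨ ν ⟩ ≡ count j Δ⟨ ν ⟩

  BalancedOff : List Var → (Fin n → ℕ) → Set
  BalancedOff V ν = ∀ j → j ∉ V → BalancedAt j ν

  Nontrivial : (Fin n → ℕ) → Set
  Nontrivial ν = ∃ λ i → ν i > 0

  slope : Var → (Fin n → ℕ) → ℚ
  slope m ν = ι (count m Δ⟨ ν ⟩) - ι (count m Γ⟨ ν ⟩)

  slack-lincomb : ∀ v a ν b μ → slack v (lincomb a ν b μ) ≡ ι a * slack v ν + ι b * slack v μ
  slack-lincomb v a ν b μ = trans
    (cong₂ _-_ (sumV-⨄-lincomb v a ν b μ (proj₂ ∘ H) (allFin n)) (sumV-⨄-lincomb v a ν b μ (proj₁ ∘ H) (allFin n)))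
    (solve 6 (λ a b d d′ g g′ → (a :* d :+ b :* d′) :- (a :* g :+ b :* g′) := a :* (d :- g) :+ b :* (d′ :- g′)) refl
      (ι a) (ι b) (sumV v Δ⟨ ν ⟩) (sumV v Δ⟨ μ ⟩) (sumV v Γ⟨ ν ⟩) (sumV v Γ⟨ μ ⟩))
    where open +-*-Solver

  slack-shift : ∀ m y v ν → slack (shift m y v) ν ≡ slope m ν * y + slack v ν
  slack-shift m y v ν = trans (cong₂ _-_ (sumV-shift m y v Δ⟨ ν ⟩) (sumV-shift m y v Γ⟨ ν ⟩))
    (solve 5 (λ c c′ y d g → (c :* y :+ d) :- (c′ :* y :+ g) := (c :- c′) :* y :+ (d :- g)) refl
      (ι (count m Δ⟨ ν ⟩)) (ι (count m Γ⟨ ν ⟩)) y (sumV v Δ⟨ ν ⟩) (sumV v Γ⟨ ν ⟩))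
    where open +-*-Solver

  balancedAt-lincomb : ∀ {j ν μ} a b → BalancedAt j ν → BalancedAt j μ → BalancedAt j (lincomb a ν b μ)
  balancedAt-lincomb {j} {ν} {μ} a b ν-bal μ-bal = begin
    count j Γ⟨ lincomb a ν b μ ⟩                    ≡⟨ count-⨄-lincomb j a ν b μ (proj₁ ∘ H) (allFin n) ⟩
    a ℕ.* count j Γ⟨ ν ⟩ ℕ.+ b ℕ.* count j Γ⟨ μ ⟩  ≡⟨ cong₂ (λ x y → a ℕ.* x ℕ.+ b ℕ.* y) ν-bal μ-bal ⟩
    a ℕ.* count j Δ⟨ ν ⟩ ℕ.+ b ℕ.* count j Δ⟨ μ ⟩  ≡⟨ count-⨄-lincomb j a ν b μ (proj₂ ∘ H) (allFin n) ⟨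
    count j Δ⟨ lincomb a ν b μ ⟩                    ∎
    where open ≡-Reasoning

  nontrivial-lincomb : ∀ {a ν} b μ → a > 0 → Nontrivial ν → Nontrivial (lincomb a ν b μ)
  nontrivial-lincomb {a} {ν} b μ a>0 (i , νi>0) =
    i , ℕ.<-≤-trans (ℕ.*-mono-≤ a>0 νi>0) (ℕ.m≤m+n (a ℕ.* ν i) (b ℕ.* μ i))

  balancedOff-∷⁻ : ∀ {m V ν} → BalancedAt m ν → BalancedOff (m ∷ V) ν → BalancedOff V ν
  balancedOff-∷⁻ {m} at-m off j j∉V with j ℕ.≟ m
  ... | yes refl = at-m
  ... | no j≢m   = off j λ { (here j≡m) → j≢m j≡m ; (there j∈V) → j∉V j∈V }

  module Step (m : Var) (S : List (Fin n → ℕ)) where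

    g d : (Fin n → ℕ) → ℕ
    g ν = count m Γ⟨ ν ⟩
    d ν = count m Δ⟨ ν ⟩

    g≟d : ∀ ν → Dec (g ν ≡ d ν)
    g≟d ν = g ν ℕ.≟ d ν

    g<?d : ∀ ν → Dec (g ν ℕ.< d ν)
    g<?d ν = g ν ℕ.<? d ν

    d<?g : ∀ ν → Dec (d ν ℕ.< g ν)
    d<?g ν = d ν ℕ.<? g ν

    zs ps ns : List (Fin n → ℕ)
    zs = filter g≟d S
    ps = filter g<?d S
    ns = filter d<?g S

    cancel : (Fin n → ℕ) → (Fin n → ℕ) → Fin n → ℕ
    cancel p q = lincomb (g q ∸ d q) p (d p ∸ g p) q

    S′ : List (Fin n → ℕ)
    S′ = zs ++ cartesianProductWith cancel ps ns

    all-S′ : ∀ (P : (Fin n → ℕ) → Set) →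
      (∀ {ν} → ν ∈ S → g ν ≡ d ν → P ν) →
      (∀ {p q} → p ∈ S → g p ℕ.< d p → q ∈ S → d q ℕ.< g q → P (cancel p q)) →
      All P S′
    all-S′ P kept combined = All.tabulate λ ν∈S′ → from-parts (∈-++⁻ zs ν∈S′)
      where
      from-parts : ∀ {ν} → ν ∈ zs ⊎ ν ∈ cartesianProductWith cancel ps ns → P ν
      from-parts (inj₁ ν∈zs) = let ν∈S , gν≡dν = ∈-filter⁻ g≟d {xs = S} ν∈zs in kept ν∈S gν≡dν
      from-parts (inj₂ ν∈pairs) with ∈-cartesianProductWith⁻ cancel ps ns ν∈pairs
      ... | p , q , p∈ps , q∈ns , refl =
        let p∈S , gp<dp = ∈-filter⁻ g<?d {xs = S} p∈ps
            q∈S , dq<gq = ∈-filter⁻ d<?g {xs = S} q∈ns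
        in combined p∈S gp<dp q∈S dq<gq

    nontrivial : All Nontrivial S → All Nontrivial S′
    nontrivial nt = all-S′ Nontrivial (λ ν∈S _ → All.lookup nt ν∈S)
      (λ {p} {q} p∈S _ _ dq<gq → nontrivial-lincomb {ν = p} (d p ∸ g p) q (ℕ.m<n⇒0<n∸m dq<gq) (All.lookup nt p∈S))

    balanced : ∀ {V} → All (BalancedOff (m ∷ V)) S → All (BalancedOff V) S′
    balanced {V} bal = all-S′ (BalancedOff V) (λ {ν} ν∈S eq → balancedOff-∷⁻ {ν = ν} eq (All.lookup bal ν∈S)) combined
      where
      combined : ∀ {p q} → p ∈ S → g p ℕ.< d p → q ∈ S → d q ℕ.< g q → BalancedOff V (cancel p q)
      combined {p} {q} p∈S gp<dp q∈S dq<gq = balancedOff-∷⁻ {ν = cancel p q} at-m off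
        where
        open ≡-Reasoning
        at-m : BalancedAt m (cancel p q)
        at-m = begin
          count m Γ⟨ cancel p q ⟩                        ≡⟨ count-⨄-lincomb m (g q ∸ d q) p (d p ∸ g p) q (proj₁ ∘ H) (allFin n) ⟩
          (g q ∸ d q) ℕ.* g p ℕ.+ (d p ∸ g p) ℕ.* g q   ≡⟨ cross-balance (ℕ.<⇒≤ gp<dp) (ℕ.<⇒≤ dq<gq) ⟩
          (g q ∸ d q) ℕ.* d p ℕ.+ (d p ∸ g p) ℕ.* d q   ≡⟨ count-⨄-lincomb m (g q ∸ d q) p (d p ∸ g p) q (proj₂ ∘ H) (allFin n) ⟨
          count m Δ⟨ cancel p q ⟩                        ∎
        off : BalancedOff (m ∷ V) (cancel p q)
        off j j∉ = balancedAt-lincomb {ν = p} {μ = q} (g q ∸ d q) (d p ∸ g p) (All.lookup bal p∈S j j∉) (All.lookup bal q∈S j j∉)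

    slope-flat : ∀ {ν} → g ν ≡ d ν → slope m ν ≡ 0ℚ
    slope-flat {ν} gν≡dν = trans (cong (λ k → ι (d ν) - ι k) gν≡dν) (ℚ.+-inverseʳ (ι (d ν)))

    slope-pos : ∀ {ν} → g ν ℕ.< d ν → 0ℚ < slope m ν
    slope-pos gν<dν = subst (0ℚ <_) (ι-∸ (ℕ.<⇒≤ gν<dν)) (ι-pos (ℕ.m<n⇒0<n∸m gν<dν))

    ι-∸-slope : ∀ {ν} → d ν ℕ.≤ g ν → ι (g ν ∸ d ν) ≡ - slope m ν
    ι-∸-slope {ν} dν≤gν = trans (ι-∸ dν≤gν) (solve 2 (λ x y → x :- y := :- (y :- x)) refl (ι (g ν)) (ι (d ν)))
      where open +-*-Solver

    slope-neg : ∀ {ν} → d ν ℕ.< g ν → slope m ν < 0ℚ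
    slope-neg {ν} dν<gν = subst₂ _<_ (solve 1 (λ x → :- (:- x) := x) refl (slope m ν)) refl
      (ℚ.neg-antimono-< (subst (0ℚ <_) (ι-∸-slope {ν} (ℕ.<⇒≤ dν<gν)) (ι-pos (ℕ.m<n⇒0<n∸m dν<gν))))
      where open +-*-Solver

    slack-cancel : ∀ v {p q} → p ∈ ps → q ∈ ns →
      slack v (cancel p q) ≡ (- slope m q) * slack v p + slope m p * slack v q
    slack-cancel v {p} {q} p∈ps q∈ns = trans (slack-lincomb v (g q ∸ d q) p (d p ∸ g p) q)
      (cong₂ (λ a b → a * slack v p + b * slack v q)
        (ι-∸-slope {q} (ℕ.<⇒≤ (proj₂ (∈-filter⁻ d<?g {xs = S} q∈ns))))
        (ι-∸ (ℕ.<⇒≤ (proj₂ (∈-filter⁻ g<?d {xs = S} p∈ps)))))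

    refute : ∀ v → All (λ ν → slack v ν < 0ℚ) S′ → ∃ λ y → All (λ ν → slack (shift m y v) ν < 0ℚ) S
    refute v S′<0 = y , All.tabulate λ {ν} ν∈S →
      subst (_< 0ℚ) (sym (slack-shift m y v ν)) (by-comparison ν∈S (ℕ.<-cmp (g ν) (d ν)))
      where
      feasible : ∃ λ y → All (λ ν → slope m ν * y + slack v ν < 0ℚ) ps × All (λ ν → slope m ν * y + slack v ν < 0ℚ) ns
      feasible = affine-feasible (slope m) (slack v) ps ns
        (All.tabulate λ {ν} ν∈ps → slope-pos {ν} (proj₂ (∈-filter⁻ g<?d {xs = S} ν∈ps)))
        (All.tabulate λ {ν} ν∈ns → slope-neg {ν} (proj₂ (∈-filter⁻ d<?g {xs = S} ν∈ns)))
        (λ p∈ps q∈ns → subst (_< 0ℚ) (slack-cancel v p∈ps q∈ns)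
                         (All.lookup S′<0 (∈-++⁺ʳ zs (∈-cartesianProductWith⁺ cancel p∈ps q∈ns))))
      y : ℚ
      y = proj₁ feasible
      by-comparison : ∀ {ν} → ν ∈ S → Tri (g ν ℕ.< d ν) (g ν ≡ d ν) (g ν ℕ.> d ν) → slope m ν * y + slack v ν < 0ℚ
      by-comparison ν∈S (tri< gν<dν _ _) = All.lookup (proj₁ (proj₂ feasible)) (∈-filter⁺ g<?d ν∈S gν<dν)
      by-comparison ν∈S (tri> _ _ dν<gν) = All.lookup (proj₂ (proj₂ feasible)) (∈-filter⁺ d<?g ν∈S dν<gν)
      by-comparison {ν} ν∈S (tri≈ _ gν≡dν _) =
        subst (_< 0ℚ) (sym flat) (All.lookup S′<0 (∈-++⁺ˡ (∈-filter⁺ g≟d ν∈S gν≡dν)))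
        where
        flat : slope m ν * y + slack v ν ≡ slack v ν
        flat = trans (cong (λ s → s * y + slack v ν) (slope-flat {ν} gν≡dν))
                     (trans (cong (_+ slack v ν) (ℚ.*-zeroˡ y)) (ℚ.+-identityˡ (slack v ν)))

    covers : Covers S → Covers S′
    covers S-covers v with Any.any? (λ ν → 0ℚ ℚ.≤? slack v ν) S′
    ... | yes holds = holds
    ... | no ¬holds =
      let y , S<0 = refute v (All.map ℚ.≰⇒> (All.¬Any⇒All¬ S′ ¬holds))
      in contradiction (S-covers (shift m y v))
           (All.All¬⇒¬Any (All.map (λ s<0 0≤s → ℚ.<-irrefl refl (ℚ.<-≤-trans s<0 0≤s)) S<0))

  eliminate : ∀ V S → All Nontrivial S → All (BalancedOff V) S → Covers S →
    ∃ λ ν → Nontrivial ν × (∀ j → BalancedAt j ν)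
  eliminate [] S nt bal S-covers =
    let ν , ν∈S , _ = find (S-covers (λ _ → 0ℚ)) in ν , All.lookup nt ν∈S , λ j → All.lookup bal ν∈S j λ ()
  eliminate (m ∷ V) S nt bal S-covers =
    eliminate V (Step.S′ m S) (Step.nontrivial m S nt) (Step.balanced m S bal) (Step.covers m S S-covers)

  variables : Multiset
  variables = concat (map (λ i → proj₁ (H i) ++ proj₂ (H i)) (allFin n))

  unit-nontrivial : ∀ i → Nontrivial (unit i)
  unit-nontrivial i = i , subst (_> 0) (sym (unit-self i)) ℕ.z<s

  unit-balancedOff : ∀ i → BalancedOff variables (unit i)
  unit-balancedOff i j j∉variables = begin
    count j Γ⟨ unit i ⟩     ≡⟨ cong (count j) (bigUnion-unit i (proj₁ ∘ H)) ⟩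
    count j (proj₁ (H i))   ≡⟨ count-∉ (proj₁ (H i)) (j∉variables ∘ occurs ∘ ∈-++⁺ˡ) ⟩
    0                       ≡⟨ count-∉ (proj₂ (H i)) (j∉variables ∘ occurs ∘ ∈-++⁺ʳ (proj₁ (H i))) ⟨
    count j (proj₂ (H i))   ≡⟨ cong (count j) (bigUnion-unit i (proj₂ ∘ H)) ⟨
    count j Δ⟨ unit i ⟩     ∎
    where
    open ≡-Reasoning
    occurs : j ∈ proj₁ (H i) ++ proj₂ (H i) → j ∈ variables
    occurs j∈ = ∈-concat⁺′ j∈ (∈-map⁺ (λ k → proj₁ (H k) ++ proj₂ (H k)) (∈-allFin i))

  unit-holds : ∀ v i → sumV v (proj₁ (H i)) ≤ sumV v (proj₂ (H i)) → Holds v (unit i)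
  unit-holds v i Γ≤Δ = subst₂ (λ Γ Δ → 0ℚ ≤ sumV v Δ - sumV v Γ)
    (sym (bigUnion-unit i (proj₁ ∘ H))) (sym (bigUnion-unit i (proj₂ ∘ H))) (p≤q⇒0≤q-p Γ≤Δ)

  valid⇒balanced : ValidA H → ∃ λ ν → Nontrivial ν × (∀ j → BalancedAt j ν)
  valid⇒balanced valid = eliminate variables (map unit (allFin n))
    (All.map⁺ (All.tabulate λ {i} _ → unit-nontrivial i))
    (All.map⁺ (All.tabulate λ {i} _ → unit-balancedOff i))
    (λ v → let i , Γ≤Δ = valid v in lose (∈-map⁺ unit (∈-allFin i)) (unit-holds v i Γ≤Δ))

balanced⇒valid : ∀ {n} (H : Hypersequent n) lam i → lam i > 0 →
  bigUnion lam (proj₁ ∘ H) ↭ bigUnion lam (proj₂ ∘ H) → ValidA H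
balanced⇒valid H lam i lam-i>0 perm v with any? (λ k → sumV v (proj₁ (H k)) ℚ.≤? sumV v (proj₂ (H k)))
... | yes holds = holds
... | no ¬holds = contradiction (sumV-⨄-< v lam (λ k → ℚ.≰⇒> (¬holds ∘ (k ,_))) (∈-allFin i) lam-i>0)
                                (ℚ.<-irrefl (sym (sumV-↭ v perm)))

mainTheorem3 : ∀ (n : ℕ) (H : Hypersequent n) →
    ValidA H ⇔
      (∃ λ (lam : Fin n → ℕ) →
        (∃ λ (i : Fin n) → lam i > 0) ×
        (bigUnion lam (λ i → proj₁ (H i)) ↭ bigUnion lam (λ i → proj₂ (H i))))
mainTheorem3 n H = mk⇔
  (λ valid → let ν , nontrivial , balanced = valid⇒balanced valid in ν , nontrivial , count⇒↭ _ _ balanced)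
  (λ (lam , (i , lam-i>0) , perm) → balanced⇒valid H lam i lam-i>0 perm)
  where open Elimination H
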